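{- Let $t$ be the Thue–Morse sequence, extended to all integers by setting $t(n)=t(-1-n)$ for $n<0$. Define $f(i,j)=t(i+j)$ for all $i,j\in\mathbb{Z}$. Then $f$ is frameless: there do not exist integers $m,n$ and $p,q\ge 1$ such that $f(m,n+i)=f(m+p,n+i)$ for all $0\le i\le q$ and $f(m+j,n)=f(m+j,n+q)$ for all $0\le j\le p$.
   Context: The Thue–Morse sequence is $t(n)=$ (number of $1$ bits in the binary representation of $n$) mod $2$ for $n\ge 0$. A coloring of $\mathbb{Z}\times\mathbb{Z}$ is frameless if it contains no picture frame, i.e. no rectangular block with at least two rows and columns whose first row equals its last row and whose first column equals its last column (as made explicit in the claim). -}

module Defs where

open import Data.Bool using (Bool; false; true; not)
open import Data.Nat using (ℕ)
open import Data.Nat.Binary using (ℕᵇ; zero; 2[1+_]; 1+[2_]; fromℕ)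
open import Data.Integer using (ℤ; +_; -[1+_]; _+_)

-- parity of the number of 1 bits of a binary natural
-- 2[1+ x ] = 2(x+1) = 2x+2 has binary digits of (x+1) followed by 0;
-- 1+[2 x ] = 2x+1 has digits of x followed by 1.
-- we compute parity of popcount of x+1 separately.
mutual
  popParityᵇ : ℕᵇ → Bool
  popParityᵇ zero = false
  popParityᵇ 2[1+ x ] = popParitySucᵇ x
  popParityᵇ 1+[2 x ] = not (popParityᵇ x)

  popParitySucᵇ : ℕᵇ → Bool
  popParitySucᵇ zero = true
  popParitySucᵇ 2[1+ x ] = not (popParitySucᵇ x)      -- 2x+3 = 2(x+1)+1
  popParitySucᵇ 1+[2 x ] = popParitySucᵇ x            -- 2x+2 = 2(x+1)

t : ℕ → Bool
t n = popParityᵇ (fromℕ n)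

-- extension to ℤ: t(n) = t(-1-n) for n < 0; note -[1+ k ] = -1-k so t(-1-(-1-k)) = t(k)
tℤ : ℤ → Bool
tℤ (+ n) = t n
tℤ -[1+ k ] = t k

f : ℤ → ℤ → Bool
f i j = tℤ (i + j)

PictureFrame : (ℤ → ℤ → Bool) → Set
PictureFrame g = Σ ℤ λ m → Σ ℤ λ n → Σ ℕ λ p → Σ ℕ λ q →
  (1 ≤ p) × (1 ≤ q) ×
  ((i : ℕ) → i ≤ q → g m (n + + i) ≡ g (m + + p) (n + + i)) ×
  ((j : ℕ) → j ≤ p → g (m + + j) n ≡ g (m + + j) (n + + q))
  where
  open import Data.Product using (Σ; _×_)
  open import Data.Nat using (_≤_)
  open import Relation.Binary.PropositionalEquality using (_≡_)

Frameless : (ℤ → ℤ → Bool) → Set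
Frameless g = ¬ PictureFrame g
  where open import Relation.Nullary using (¬_)

private
  open import Relation.Binary.PropositionalEquality using (_≡_; refl)
  open import Data.List using (List; map; upTo; _∷_; [])
  chk : map t (upTo 16) ≡ false ∷ true ∷ true ∷ false ∷ true ∷ false ∷ false ∷ true ∷ true ∷ false ∷ false ∷ true ∷ false ∷ true ∷ true ∷ false ∷ []
  chk = refl

module Submission where

-- A frame at (m , n) of size p × q makes the factor w i = t(m + n + i), 0 ≤ i ≤ p + q, of the
-- two-sided Thue–Morse word periodic with periods p and q.  By Fine and Wilf, w has period
-- g = gcd p q, and since 2g ≤ p + q, w contains an overlap: a factor of length 2g + 1 with
-- period g.  There are no overlaps.  An overlap of odd period d alternates (for odd d, one of the
-- pairs of positions (z , z + 1) and (z + d , z + d + 1) is aligned as (2a , 2a + 1)), so it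
-- contains the overlap ababa of period 2; an overlap of period 2c yields, on its even or its
-- odd positions, an overlap of period c of the word decimated via t(2n) = t(n).  Strong
-- induction on the period concludes.

open import Defs
open import Data.Bool using (Bool; true; false; not)
open import Data.Bool.Properties using (not-involutive; not-injective; not-¬)
open import Data.Nat using (ℕ; zero; suc; _+_; _≤_; _<_; s≤s; z≤n; z<s; >-nonZero)
open import Data.Nat.Properties
open import Data.Nat.Binary as ℕᵇ using (2[1+_]; 1+[2_]; fromℕ; double)
open import Data.Nat.Binary.Properties using (fromℕ-homo-+; fromℕ≡fromℕ'; double[x]≡x+x)
open import Data.Nat.Divisibility using (∣m+n∣m⇒∣n; ∣m∣n⇒∣m+n; ∣-antisym; ∣⇒≤)
open import Data.Nat.GCD
  using (gcd; gcd[m,n]∣m; gcd[m,n]∣n; gcd[m,n]≢0; gcd-greatest; gcd-comm; gcd-identityˡ)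
open import Data.Nat.Induction using (<-rec; <-wellFounded)
open import Data.Nat.Tactic.RingSolver using (solve-∀)
open import Data.Integer as ℤ using (ℤ; +_; -[1+_])
import Data.Integer.Tactic.RingSolver as ℤ-Solver
open import Data.Product using (_×_; ∃-syntax; _,_)
open import Data.Sum using (_⊎_; inj₁; inj₂)
open import Function.Definitions using (Injective)
open import Induction.WellFounded using (Acc; acc)
open import Relation.Binary.PropositionalEquality
open import Relation.Nullary using (¬_; yes; no)
open import Level using (Level)

popParityᵇ-suc : ∀ x → popParityᵇ (ℕᵇ.suc x) ≡ popParitySucᵇ x
popParityᵇ-suc ℕᵇ.zero = refl
popParityᵇ-suc 2[1+ x ] = cong not (popParityᵇ-suc x)
popParityᵇ-suc 1+[2 x ] = refl

popParitySucᵇ-double : ∀ x → popParitySucᵇ (double x) ≡ not (popParityᵇ x)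
popParitySucᵇ-double ℕᵇ.zero = refl
popParitySucᵇ-double 2[1+ x ] = refl
popParitySucᵇ-double 1+[2 x ] = cong not (popParitySucᵇ-double x)

popParityᵇ-double : ∀ x → popParityᵇ (double x) ≡ popParityᵇ x
popParityᵇ-double ℕᵇ.zero = refl
popParityᵇ-double 2[1+ x ] = refl
popParityᵇ-double 1+[2 x ] = popParitySucᵇ-double x

fromℕ-double : ∀ n → fromℕ (n + n) ≡ double (fromℕ n)
fromℕ-double n = trans (fromℕ-homo-+ n n) (sym (double[x]≡x+x (fromℕ n)))

fromℕ-suc : ∀ n → fromℕ (suc n) ≡ ℕᵇ.suc (fromℕ n)
fromℕ-suc n = trans (fromℕ≡fromℕ' (suc n)) (cong ℕᵇ.suc (sym (fromℕ≡fromℕ' n)))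

t-double : ∀ n → t (n + n) ≡ t n
t-double n = trans (cong popParityᵇ (fromℕ-double n)) (popParityᵇ-double (fromℕ n))

t-double+1 : ∀ n → t (suc (n + n)) ≡ not (t n)
t-double+1 n = begin
  popParityᵇ (fromℕ (suc (n + n)))        ≡⟨ cong popParityᵇ (fromℕ-suc (n + n)) ⟩
  popParityᵇ (ℕᵇ.suc (fromℕ (n + n)))     ≡⟨ popParityᵇ-suc (fromℕ (n + n)) ⟩
  popParitySucᵇ (fromℕ (n + n))           ≡⟨ cong popParitySucᵇ (fromℕ-double n) ⟩
  popParitySucᵇ (double (fromℕ n))        ≡⟨ popParitySucᵇ-double (fromℕ n) ⟩
  not (t n)                               ∎
  where open ≡-Reasoning

gcd[m,m+n]≡gcd[m,n] : ∀ m n → gcd m (m + n) ≡ gcd m n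
gcd[m,m+n]≡gcd[m,n] m n = ∣-antisym
  (gcd-greatest (gcd[m,n]∣m m (m + n)) (∣m+n∣m⇒∣n (gcd[m,n]∣n m (m + n)) (gcd[m,n]∣m m (m + n))))
  (gcd-greatest (gcd[m,n]∣m m n) (∣m∣n⇒∣m+n (gcd[m,n]∣m m n) (gcd[m,n]∣n m n)))

private variable
  a b : Level
  A B : Set a

Period : {A : Set a} → (ℕ → A) → ℕ → ℕ → Set a
Period w L p = ∀ i → p + i ≤ L → w i ≡ w (p + i)

Period-mono : ∀ {w : ℕ → A} {L L′ p} → L′ ≤ L → Period w L p → Period w L′ p
Period-mono L′≤L per i p+i≤L′ = per i (≤-trans p+i≤L′ L′≤L)

Period-difference : ∀ {w : ℕ → A} {L p r} → p + (p + r) ≤ L →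
                    Period w L p → Period w L (p + r) → Period w L r
Period-difference {w = w} {L = L} {p = p} {r = r} bound per-p per-q i r+i≤L with i <? p
... | yes i<p = trans (per-q i q+i≤L) (trans (cong w (+-assoc p r i)) (sym (per-p (r + i) p+r+i≤L)))
  where
  q+i≤L : p + r + i ≤ L
  q+i≤L = ≤-trans (+-monoʳ-≤ (p + r) (<⇒≤ i<p)) (≤-trans (≤-reflexive (+-comm (p + r) p)) bound)
  p+r+i≤L : p + (r + i) ≤ L
  p+r+i≤L = subst (_≤ L) (+-assoc p r i) q+i≤L
... | no i≮p with m≤n⇒∃[o]m+o≡n (≮⇒≥ i≮p)
...   | j , refl = trans (sym (per-p j (≤-trans (m≤n+m (p + j) r) r+i≤L)))
                   (trans (per-q j (subst (_≤ L) eq r+i≤L)) (cong w (sym eq)))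
  where
  eq : r + (p + j) ≡ p + r + j
  eq = trans (sym (+-assoc r p j)) (cong (_+ j) (+-comm r p))

fine-wilf : ∀ {w : ℕ → A} {L} p q → p + q ≤ L → Period w L p → Period w L q → Period w L (gcd p q)
fine-wilf p q = go p q (<-wellFounded (p + q))
  where
  go : ∀ {w : ℕ → A} {L} p q → Acc _<_ (p + q) → p + q ≤ L →
       Period w L p → Period w L q → Period w L (gcd p q)
  go {w = w} {L = L} zero q _ _ _ per-q = subst (Period w L) (sym (gcd-identityˡ q)) per-q
  go (suc p) zero _ _ per-p _ = per-p
  go {w = w} {L = L} p@(suc _) q@(suc _) (acc rec) p+q≤L per-p per-q with ≤-total p q
  ... | inj₁ p≤q with m≤n⇒∃[o]m+o≡n p≤q
  ...   | r , refl = subst (Period w L) (sym (gcd[m,m+n]≡gcd[m,n] p r))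
    (go p r (rec (+-monoʳ-< p (m<n+m r z<s))) (≤-trans (+-monoʳ-≤ p (m≤n+m r p)) p+q≤L)
      per-p (Period-difference p+q≤L per-p per-q))
  go {w = w} {L = L} p@(suc _) q@(suc _) (acc rec) p+q≤L per-p per-q | inj₂ q≤p with m≤n⇒∃[o]m+o≡n q≤p
  ...   | r , refl = subst (Period w L) (trans (sym (gcd[m,m+n]≡gcd[m,n] q r)) (gcd-comm q (q + r)))
    (go q r (rec (m<m+n (q + r) z<s)) (≤-trans (m≤m+n (q + r) q) p+q≤L)
      per-q (Period-difference (subst (_≤ L) (+-comm (q + r) q) p+q≤L) per-q per-p))

Overlap : {A : Set a} → (ℕ → A) → ℕ → Set a
Overlap w d = 0 < d × Period w (d + d) d

two-Periods⇒Overlap : ∀ {w : ℕ → A} {p q} → 0 < p → 0 < q →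
                      Period w (p + q) p → Period w (p + q) q → Overlap w (gcd p q)
two-Periods⇒Overlap {p = p} {q} 0<p 0<q per-p per-q =
  n≢0⇒n>0 (gcd[m,n]≢0 p q (inj₁ (m<n⇒n≢0 0<p))) ,
  Period-mono (+-mono-≤ (∣⇒≤ {{>-nonZero 0<p}} (gcd[m,n]∣m p q)) (∣⇒≤ {{>-nonZero 0<q}} (gcd[m,n]∣n p q)))
    (fine-wilf p q ≤-refl per-p per-q)

Period-evens : ∀ {w : ℕ → A} {v : ℕ → B} {g : B → A} {L c} →
               Injective _≡_ _≡_ g → (∀ i → w (i + i) ≡ g (v i)) →
               Period w (L + L) (c + c) → Period v L c
Period-evens {w = w} {v = v} {g = g} {L = L} {c = c} g-inj w≡g∘v per i c+i≤L = g-inj (begin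
  g (v i)                 ≡⟨ sym (w≡g∘v i) ⟩
  w (i + i)               ≡⟨ per (i + i) (subst (_≤ L + L) (interchange c i) (+-mono-≤ c+i≤L c+i≤L)) ⟩
  w ((c + c) + (i + i))   ≡⟨ cong w (sym (interchange c i)) ⟩
  w ((c + i) + (c + i))   ≡⟨ w≡g∘v (c + i) ⟩
  g (v (c + i))           ∎)
  where
  open ≡-Reasoning
  interchange : ∀ m n → (m + n) + (m + n) ≡ (m + m) + (n + n)
  interchange = solve-∀

parity : ∀ n → ∃[ m ] (n ≡ m + m ⊎ n ≡ suc (m + m))
parity zero = 0 , inj₁ refl
parity (suc n) with parity n
... | m , inj₁ refl = m , inj₂ refl
... | m , inj₂ refl = suc m , inj₁ (cong suc (sym (+-suc m m)))

ℤ-parity : ∀ x → ∃[ y ] (x ≡ y ℤ.+ y ⊎ x ≡ y ℤ.+ y ℤ.+ + 1)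
ℤ-parity (+ n) with parity n
... | m , inj₁ refl = + m , inj₁ refl
... | m , inj₂ refl = + m , inj₂ (cong +_ (+-comm 1 (m + m)))
ℤ-parity -[1+ n ] with parity n
... | m , inj₁ refl = -[1+ m ] , inj₂ refl
... | m , inj₂ refl = -[1+ m ] , inj₁ refl

Alternating : (ℕ → Bool) → ℕ → Set
Alternating w L = ∀ i → suc i ≤ L → w (suc i) ≡ not (w i)

Alternating⇒Period-2 : ∀ {w L} → Alternating w L → Period w L 2
Alternating⇒Period-2 {w} alt i 2+i≤L = sym (begin
  w (suc (suc i))   ≡⟨ alt (suc i) 2+i≤L ⟩
  not (w (suc i))   ≡⟨ cong not (alt i (≤-trans (n≤1+n _) 2+i≤L)) ⟩
  not (not (w i))   ≡⟨ not-involutive (w i) ⟩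
  w i               ∎)
  where open ≡-Reasoning

Period-extends-Alternating : ∀ {w d} → Period w (d + d) d → Alternating w d → Alternating w (d + d)
Period-extends-Alternating {w} {d} per alt i 1+i≤2d with i <? d
... | yes i<d = alt i i<d
... | no i≮d with m≤n⇒∃[o]m+o≡n (≮⇒≥ i≮d)
...   | j , refl = begin
  w (suc (d + j))   ≡⟨ cong w (sym (+-suc d j)) ⟩
  w (d + suc j)     ≡⟨ sym (per (suc j) (subst (_≤ d + d) (sym (+-suc d j)) 1+i≤2d)) ⟩
  w (suc j)         ≡⟨ alt j (+-cancelˡ-≤ d (suc j) d (subst (_≤ d + d) (sym (+-suc d j)) 1+i≤2d)) ⟩
  not (w j)         ≡⟨ cong not (per j (≤-trans (n≤1+n _) 1+i≤2d)) ⟩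
  not (w (d + j))   ∎
  where open ≡-Reasoning

suffix : (ℤ → A) → ℤ → ℕ → A
suffix s x i = s (x ℤ.+ + i)

module OverlapFree {I : Set} (s : I → ℤ → Bool) (evens : I → I)
  (s-double   : ∀ k y → s k (y ℤ.+ y) ≡ s (evens k) y)
  (s-double+1 : ∀ k y → s k (y ℤ.+ y ℤ.+ + 1) ≡ not (s k (y ℤ.+ y))) where

  open ≡-Reasoning

  s-alternates-across-odd-shift : ∀ k z o → let z′ = z ℤ.+ (o ℤ.+ o ℤ.+ + 1) in
    s k z ≡ s k z′ → s k (z ℤ.+ + 1) ≡ s k (z′ ℤ.+ + 1) → s k (z ℤ.+ + 1) ≡ not (s k z)
  s-alternates-across-odd-shift k z o z≈z′ z+1≈z′+1 with ℤ-parity z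
  ... | y , inj₁ refl = s-double+1 k y
  ... | y , inj₂ refl = begin
    s k (y ℤ.+ y ℤ.+ + 1 ℤ.+ + 1)                       ≡⟨ z+1≈z′+1 ⟩
    s k (y ℤ.+ y ℤ.+ + 1 ℤ.+ (o ℤ.+ o ℤ.+ + 1) ℤ.+ + 1)  ≡⟨ cong (s k) (eq₁ y o) ⟩
    s k (e ℤ.+ e ℤ.+ + 1)                               ≡⟨ s-double+1 k e ⟩
    not (s k (e ℤ.+ e))                                 ≡⟨ cong (λ u → not (s k u)) (eq₀ y o) ⟨
    not (s k (y ℤ.+ y ℤ.+ + 1 ℤ.+ (o ℤ.+ o ℤ.+ + 1)))    ≡⟨ cong not z≈z′ ⟨
    not (s k (y ℤ.+ y ℤ.+ + 1))                         ∎
    where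
    e : ℤ
    e = y ℤ.+ o ℤ.+ + 1
    eq₀ : ∀ y o → y ℤ.+ y ℤ.+ + 1 ℤ.+ (o ℤ.+ o ℤ.+ + 1) ≡ (y ℤ.+ o ℤ.+ + 1) ℤ.+ (y ℤ.+ o ℤ.+ + 1)
    eq₀ = ℤ-Solver.solve-∀
    eq₁ : ∀ y o → y ℤ.+ y ℤ.+ + 1 ℤ.+ (o ℤ.+ o ℤ.+ + 1) ℤ.+ + 1 ≡ (y ℤ.+ o ℤ.+ + 1) ℤ.+ (y ℤ.+ o ℤ.+ + 1) ℤ.+ + 1
    eq₁ = ℤ-Solver.solve-∀

  odd-Period⇒Alternating : ∀ k x c → let d = suc (c + c) in
    Period (suffix (s k) x) (d + d) d → Alternating (suffix (s k) x) (d + d)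
  odd-Period⇒Alternating k x c per = Period-extends-Alternating per step
    where
    d : ℕ
    d = suc (c + c)
    -- At x , + c , + j both sides unfold definitionally to the positions related by per.
    shift-suc : ∀ x j → x ℤ.+ (+ 1 ℤ.+ j) ≡ x ℤ.+ j ℤ.+ + 1
    shift-suc = ℤ-Solver.solve-∀
    shift-odd : ∀ x c j → x ℤ.+ (+ 1 ℤ.+ (c ℤ.+ c ℤ.+ j)) ≡ x ℤ.+ j ℤ.+ (c ℤ.+ c ℤ.+ + 1)
    shift-odd = ℤ-Solver.solve-∀
    shift-odd-suc : ∀ x c j →
      x ℤ.+ (+ 1 ℤ.+ (c ℤ.+ c ℤ.+ (+ 1 ℤ.+ j))) ≡ x ℤ.+ j ℤ.+ (c ℤ.+ c ℤ.+ + 1) ℤ.+ + 1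
    shift-odd-suc = ℤ-Solver.solve-∀
    step : Alternating (suffix (s k) x) d
    step j 1+j≤d = trans (cong (s k) (shift-suc x (+ j)))
      (s-alternates-across-odd-shift k (x ℤ.+ + j) (+ c) at-j at-1+j)
      where
      z z′ : ℤ
      z = x ℤ.+ + j
      z′ = z ℤ.+ (+ c ℤ.+ + c ℤ.+ + 1)
      at-j : s k z ≡ s k z′
      at-j = trans (per j (≤-trans (+-monoʳ-≤ d (n≤1+n j)) (+-monoʳ-≤ d 1+j≤d)))
        (cong (s k) (shift-odd x (+ c) (+ j)))
      at-1+j : s k (z ℤ.+ + 1) ≡ s k (z′ ℤ.+ + 1)
      at-1+j = trans (cong (s k) (sym (shift-suc x (+ j))))
        (trans (per (suc j) (+-monoʳ-≤ d 1+j≤d)) (cong (s k) (shift-odd-suc x (+ c) (+ j))))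

  Period-suffix-evens : ∀ k x {L c} → Period (suffix (s k) x) (L + L) (c + c) →
                        ∃[ y ] Period (suffix (s (evens k)) y) L c
  Period-suffix-evens k x per with ℤ-parity x
  ... | y , inj₁ refl = y , Period-evens (λ eq → eq)
          (λ i → trans (cong (s k) (even-shift y (+ i))) (s-double k (y ℤ.+ + i))) per
    where
    even-shift : ∀ y i → y ℤ.+ y ℤ.+ (i ℤ.+ i) ≡ (y ℤ.+ i) ℤ.+ (y ℤ.+ i)
    even-shift = ℤ-Solver.solve-∀
  ... | y , inj₂ refl = y , Period-evens not-injective
          (λ i → trans (cong (s k) (odd-shift y (+ i)))
                   (trans (s-double+1 k (y ℤ.+ + i)) (cong not (s-double k (y ℤ.+ + i))))) per
    where
    odd-shift : ∀ y i → y ℤ.+ y ℤ.+ + 1 ℤ.+ (i ℤ.+ i) ≡ (y ℤ.+ i) ℤ.+ (y ℤ.+ i) ℤ.+ + 1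
    odd-shift = ℤ-Solver.solve-∀

  overlap-free : ∀ k x d → ¬ Overlap (suffix (s k) x) d
  overlap-free k x d = <-rec (λ d → ∀ k x → ¬ Overlap (suffix (s k) x) d) go d k x
    where
    go : ∀ d → (∀ {d′} → d′ < d → ∀ k x → ¬ Overlap (suffix (s k) x) d′) →
         ∀ k x → ¬ Overlap (suffix (s k) x) d
    go d ih k x (0<d , per) with parity d
    ... | zero , inj₁ refl = <-irrefl refl 0<d
    ... | suc c , inj₁ refl with Period-suffix-evens k x per
    ...   | y , per′ = ih (m<m+n (suc c) z<s) (evens k) y (z<s , per′)
    go d ih k x (_ , per) | zero , inj₂ refl =
      not-¬ (sym (per 0 (s≤s z≤n))) (odd-Period⇒Alternating k x 0 per 0 (s≤s z≤n))
    go d ih k x (_ , per) | suc c , inj₂ refl = ih 2<d k x (z<s , Period-mono (+-mono-≤ 2≤d 2≤d) period-2)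
      where
      period-2 : Period (suffix (s k) x) (suc (suc c + suc c) + suc (suc c + suc c)) 2
      period-2 = Alternating⇒Period-2 (odd-Period⇒Alternating k x (suc c) per)
      2<d : 2 < suc (suc c + suc c)
      2<d = s≤s (s≤s (≤-trans (s≤s z≤n) (m≤n+m (suc c) c)))
      2≤d : 2 ≤ suc (suc c + suc c)
      2≤d = <⇒≤ 2<d

-- tm false is tℤ, and the even positions of tm b form tm (not b): on the negative half,
-- tℤ (2 · -[1+ n ]) = t (2n + 1) = not (t n).
tm : Bool → ℤ → Bool
tm false x = tℤ x
tm true (+ n) = t n
tm true -[1+ n ] = not (t n)

t-flip : ∀ n → t (suc (n + n)) ≡ not (t (n + n))
t-flip n = trans (t-double+1 n) (cong not (sym (t-double n)))

t-flip′ : ∀ n → t (n + n) ≡ not (t (suc (n + n)))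
t-flip′ n = sym (trans (cong not (t-flip n)) (not-involutive (t (n + n))))

tm-double : ∀ b y → tm b (y ℤ.+ y) ≡ tm (not b) y
tm-double false (+ n) = t-double n
tm-double true (+ n) = t-double n
tm-double false -[1+ n ] = t-double+1 n
tm-double true -[1+ n ] = trans (cong not (t-double+1 n)) (not-involutive (t n))

tm-double+1 : ∀ b y → tm b (y ℤ.+ y ℤ.+ + 1) ≡ not (tm b (y ℤ.+ y))
tm-double+1 false (+ n) = trans (cong t (+-comm (n + n) 1)) (t-flip n)
tm-double+1 true (+ n) = trans (cong t (+-comm (n + n) 1)) (t-flip n)
tm-double+1 false -[1+ n ] = t-flip′ n
tm-double+1 true -[1+ n ] = cong not (t-flip′ n)

open OverlapFree tm not tm-double tm-double+1

rows⇒Period : ∀ m n {p q} → (∀ i → i ≤ q → f m (n ℤ.+ + i) ≡ f (m ℤ.+ + p) (n ℤ.+ + i)) →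
              Period (suffix tℤ (m ℤ.+ n)) (p + q) p
rows⇒Period m n {p} {q} rows i p+i≤p+q = trans (cong tℤ (reassoc m n (+ i)))
  (trans (rows i (+-cancelˡ-≤ p i q p+i≤p+q)) (cong tℤ (shift m n (+ p) (+ i))))
  where
  reassoc : ∀ m n i → m ℤ.+ n ℤ.+ i ≡ m ℤ.+ (n ℤ.+ i)
  reassoc = ℤ-Solver.solve-∀
  shift : ∀ m n p i → m ℤ.+ p ℤ.+ (n ℤ.+ i) ≡ m ℤ.+ n ℤ.+ (p ℤ.+ i)
  shift = ℤ-Solver.solve-∀

cols⇒Period : ∀ m n {p q} → (∀ j → j ≤ p → f (m ℤ.+ + j) n ≡ f (m ℤ.+ + j) (n ℤ.+ + q)) →
              Period (suffix tℤ (m ℤ.+ n)) (p + q) q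
cols⇒Period m n {p} {q} cols j q+j≤p+q = trans (cong tℤ (reassoc m n (+ j)))
  (trans (cols j (+-cancelˡ-≤ q j p (subst (q + j ≤_) (+-comm p q) q+j≤p+q)))
    (cong tℤ (shift m n (+ j) (+ q))))
  where
  reassoc : ∀ m n j → m ℤ.+ n ℤ.+ j ≡ m ℤ.+ j ℤ.+ n
  reassoc = ℤ-Solver.solve-∀
  shift : ∀ m n j q → m ℤ.+ j ℤ.+ (n ℤ.+ q) ≡ m ℤ.+ n ℤ.+ (q ℤ.+ j)
  shift = ℤ-Solver.solve-∀

theorem2 : Frameless f
theorem2 (m , n , p , q , 0<p , 0<q , rows , cols) =
  overlap-free false (m ℤ.+ n) (gcd p q)
    (two-Periods⇒Overlap 0<p 0<q (rows⇒Period m n rows) (cols⇒Period m n cols))
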